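{- Given a suffix AVL tree $\mathrm{SAVL}$ of a text $T$ for a set of positions $P$, the sparse LCP array $\mathrm{SLCP}$ of $T$ with respect to $P$ can be computed in time linear in the number of nodes of $\mathrm{SAVL}$.
   Context: Let $T[1..n]$ be a text, $T[p..]$ its suffix starting at position $p$, $\prec$ the lexicographic order on strings, and $\mathrm{lcp}(X,Y)$ the length of the longest common prefix of strings $X,Y$. Let $P=\{p_1,\dots,p_m\}\subseteq[1..n]$. The sparse suffix array $\mathrm{SSA}[1..m]$ lists the positions of $P$ so that $T[\mathrm{SSA}[i]..]\prec T[\mathrm{SSA}[i+1]..]$ for all $i$. The sparse LCP array is defined by $\mathrm{SLCP}[1]=0$ and $\mathrm{SLCP}[i]=\mathrm{lcp}(T[\mathrm{SSA}[i-1]..],T[\mathrm{SSA}[i]..])$ for $i\in[2..m]$. A suffix AVL tree $\mathrm{SAVL}$ for $P$ is a binary search tree whose nodes are the positions of $P$ (identified with the suffixes they start) such that an in-order traversal yields $\mathrm{SSA}$ (it may, but need not, be balanced as an AVL tree). For a node $v$, $\mathrm{cla}_v$ (resp. $\mathrm{cra}_v$) is the lowest node having $v$ as a descendant in its left (resp. right) subtree, if it exists. Each node $v$ stores a pair $(d_v,m_v)$ with $d_v\in\{\mathtt{left},\mathtt{right},\bot\}$: $m_v=\mathrm{lcp}(T[v..],T[\mathrm{cla}_v..])$ if $d_v=\mathtt{left}$, $m_v=\mathrm{lcp}(T[v..],T[\mathrm{cra}_v..])$ if $d_v=\mathtt{right}$, and $m_v=0$ if $d_v=\bot$, where $d_v$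 is chosen (among the existing options) so that $m_v$ is maximized. The tree stores only this information (node positions, tree pointers, and the pairs $(d_v,m_v)$). -}

module Defs where

open import Data.Nat using (ℕ; zero; suc; _+_; _*_; _∸_; _≤_; _<_; _≡ᵇ_)
open import Data.Nat.Properties using (_≟_)
open import Data.List using (List; []; _∷_; drop; length; _++_; reverse; lookup)
open import Data.List.Relation.Unary.All using (All)
open import Data.List.Relation.Unary.Linked using (Linked)
open import Data.List.Relation.Binary.Lex.Strict using (Lex-<)
open import Data.Maybe using (Maybe; just; nothing)
open import Data.Bool using (if_then_else_)
open import Data.Product using (Σ; _×_; _,_)
open import Data.Unit using (⊤)
open import Relation.Binary.PropositionalEquality using (_≡_)
open import Relation.Nullary using (yes; no)

-- Texts, suffixes, lcp, lexicographic order
-- Text over the integer alphabet ℕ; positions are 0-based: T[p..] = drop p T.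

Text : Set
Text = List ℕ

suf : Text → ℕ → List ℕ
suf T p = drop p T

lcp : List ℕ → List ℕ → ℕ
lcp []       _        = 0
lcp (_ ∷ _)  []       = 0
lcp (x ∷ xs) (y ∷ ys) with x ≟ y
... | yes _ = suc (lcp xs ys)
... | no  _ = 0

-- strict lexicographic order (a proper prefix is smaller)
_≺_ : List ℕ → List ℕ → Set
_≺_ = Lex-< _≡_ _<_

data Dir : Set where
  left right ⊥d : Dir

data Tree : Set where
  leaf : Tree
  node : (l : Tree) (p : ℕ) (d : Dir) (mv : ℕ) (r : Tree) → Tree

size : Tree → ℕ
size leaf             = 0
size (node l _ _ _ r) = suc (size l + size r)

inorder : Tree → List ℕ
inorder leaf             = []
inorder (node l p _ _ r) = inorder l ++ (p ∷ inorder r)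

-- (d , mv) is an admissible choice for the node at position p, given
-- cla (lowest ancestor having the node in its left subtree) and cra
data Option (T : Text) (p : ℕ) : Maybe ℕ → Maybe ℕ → Dir → ℕ → Set where
  optLeft  : ∀ {a cra} → Option T p (just a) cra left (lcp (suf T p) (suf T a))
  optRight : ∀ {cla a} → Option T p cla (just a) right (lcp (suf T p) (suf T a))
  optNone  : ∀ {cla cra} → Option T p cla cra ⊥d 0

Annot : Text → ℕ → Maybe ℕ → Maybe ℕ → Dir → ℕ → Set
Annot T p cla cra d mv =
  Option T p cla cra d mv × (∀ d′ m′ → Option T p cla cra d′ m′ → m′ ≤ mv)

AnnOK : Text → Maybe ℕ → Maybe ℕ → Tree → Set
AnnOK T cla cra leaf             = ⊤
AnnOK T cla cra (node l p d mv r) =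
  Annot T p cla cra d mv × AnnOK T (just p) cra l × AnnOK T cla (just p) r

-- t is a suffix AVL tree of T for the set of positions P = nodes of t
IsSAVL : Text → Tree → Set
IsSAVL T t =
  All (_< length T) (inorder t)
  × Linked (λ p q → suf T p ≺ suf T q) (inorder t)
  × AnnOK T nothing nothing t

slcpFrom : Text → ℕ → List ℕ → List ℕ
slcpFrom T prev []       = []
slcpFrom T prev (q ∷ qs) = lcp (suf T prev) (suf T q) ∷ slcpFrom T q qs

slcpOf : Text → List ℕ → List ℕ
slcpOf T []       = []
slcpOf T (p ∷ ps) = 0 ∷ slcpFrom T p ps

-- SSA is the in-order traversal of the tree
SLCP : Text → Tree → List ℕ
SLCP T t = slcpOf T (inorder t)

-- Machine model: unit-cost RAM, every instruction costs one step.

Memory : Set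
Memory = ℕ → ℕ

data Instr : Set where
  const : (r k : ℕ) → Instr
  add   : (r a b : ℕ) → Instr
  sub   : (r a b : ℕ) → Instr
  load  : (r a : ℕ) → Instr
  store : (a r : ℕ) → Instr
  jmpz  : (r l : ℕ) → Instr
  jmp   : (l : ℕ) → Instr
  out   : (r : ℕ) → Instr
  halt  : Instr

Program : Set
Program = List Instr

upd : Memory → ℕ → ℕ → Memory
upd M a v x = if x ≡ᵇ a then v else M x

fetch : Program → ℕ → Instr
fetch []       _       = halt
fetch (i ∷ _)  zero    = i
fetch (_ ∷ is) (suc n) = fetch is n

-- run with a budget of steps (halting counts as a step);
-- just o = halted within the budget with output o
run : Program → ℕ → (pc : ℕ) → Memory → (revOut : List ℕ) → Maybe (List ℕ)
run P zero    pc M o = nothing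
run P (suc k) pc M o with fetch P pc
... | const r c   = run P k (suc pc) (upd M r c) o
... | add r a b   = run P k (suc pc) (upd M r (M a + M b)) o
... | sub r a b   = run P k (suc pc) (upd M r (M a ∸ M b)) o
... | load r a    = run P k (suc pc) (upd M r (M (M a))) o
... | store a r   = run P k (suc pc) (upd M (M a) (M r)) o
... | jmpz r l    = run P k (if M r ≡ᵇ 0 then l else suc pc) M o
... | jmp l       = run P k l M o
... | out r       = run P k (suc pc) M (M r ∷ o)
... | halt        = just (reverse o)

-- Memory representation of a tree (only the stored information):
--   M[0] = number of nodes m, M[1] = index of the root (0 = empty tree),
--   node with index i ∈ [1..m] (arbitrary numbering) occupies the record
--   M[b], …, M[b+4] with b = 5i − 3:
--   position, index of left child, index of right child (0 = none),
--   code of d_v (0 = ⊥, 1 = left, 2 = right), m_v.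
--   All cells from 2 + 5m on are 0 (free work space).

dcode : Dir → ℕ
dcode ⊥d    = 0
dcode left  = 1
dcode right = 2

base : ℕ → ℕ
base i = 5 * i ∸ 3

RepAt : Memory → ℕ → ℕ → Tree → Set
RepAt M m i leaf              = i ≡ 0
RepAt M m i (node l p d mv r) =
  1 ≤ i × i ≤ m
  × M (base i) ≡ p
  × RepAt M m (M (base i + 1)) l
  × RepAt M m (M (base i + 2)) r
  × M (base i + 3) ≡ dcode d
  × M (base i + 4) ≡ mv

Rep : Memory → Tree → Set
Rep M t =
  M 0 ≡ size t
  × RepAt M (size t) (M 1) t
  × (∀ a → 2 + 5 * size t ≤ a → M a ≡ 0)

-- Let cra and cla be the in-order neighbours just outside a subtree and g = lcp(T[cra..], T[cla..]).
-- As the suffixes are sorted, every node v of the subtree has g = min(lcp(cra, v), lcp(v, cla)),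
-- while m_v is the larger of these two lcps and d_v names it; so both are recovered from
-- (d_v, m_v, g): the larger is m_v and the smaller is min(m_v, g). An in-order traversal that hands
-- lcp(cra, v) to the left subtree of v and lcp(v, cla) to the right one therefore reaches each node
-- holding the lcp with its predecessor in SSA, which is its SLCP entry. On the RAM the traversal keeps
-- an explicit stack of (right child, g) pairs and spends a constant number of steps per node; moving
-- the input out of the way of the registers first costs O(m) steps as well.

module Submission where

open import Defs
open import Data.Nat using (ℕ; zero; suc; _+_; _*_; _∸_; _≤_; _<_; _⊓_; _≡ᵇ_; z≤n; s≤s; z<s)
open import Data.Nat.Properties
open import Data.Nat.Solver using (module +-*-Solver)
open import Data.Bool using (true; false; if_then_else_; T)
open import Data.List using (List; []; _∷_; _++_; reverse; take; drop)
open import Data.List.Properties using (++-assoc; reverse-++; unfold-reverse; ++-identityʳ; reverse-involutive)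
open import Data.List.Relation.Unary.All as All using (All; []; _∷_)
open import Data.List.Relation.Unary.All.Properties using (++⁻ˡ; ++⁻ʳ)
open import Data.List.Relation.Unary.AllPairs using (AllPairs; []; _∷_)
open import Data.List.Relation.Unary.Linked.Properties using (Linked⇒AllPairs)
open import Data.List.Relation.Binary.Lex.Strict using (<-transitive; halt; this; next) renaming (base to lex-base)
open import Data.Maybe using (Maybe; just; nothing)
open import Data.Product using (Σ; _×_; _,_; proj₁; proj₂)
open import Data.Unit using (⊤; tt)
open import Data.Empty using (⊥-elim)
open import Data.Sum using (inj₁; inj₂)
open import Function using (_∘_)
open import Relation.Binary.PropositionalEquality
open import Relation.Nullary using (yes; no; contradiction)

open +-*-Solver using (solve; _:+_; _:*_; con; _:=_)

lcp-comm : ∀ xs ys → lcp xs ys ≡ lcp ys xs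
lcp-comm []       []       = refl
lcp-comm []       (_ ∷ _)  = refl
lcp-comm (_ ∷ _)  []       = refl
lcp-comm (x ∷ xs) (y ∷ ys) with x ≟ y | y ≟ x
... | yes _   | yes _   = cong suc (lcp-comm xs ys)
... | yes x≡y | no  y≢x = ⊥-elim (y≢x (sym x≡y))
... | no  x≢y | yes y≡x = ⊥-elim (x≢y (sym y≡x))
... | no  _   | no  _   = refl

lcp-∷-< : ∀ {x y} xs ys → x < y → lcp (x ∷ xs) (y ∷ ys) ≡ 0
lcp-∷-< {x} {y} _ _ x<y with x ≟ y
... | yes refl = ⊥-elim (<-irrefl refl x<y)
... | no  _    = refl

lcp-∷-≡ : ∀ x xs ys → lcp (x ∷ xs) (x ∷ ys) ≡ suc (lcp xs ys)
lcp-∷-≡ x _ _ with x ≟ x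
... | yes _   = refl
... | no  x≢x = ⊥-elim (x≢x refl)

≺-trans : ∀ {a b c} → a ≺ b → b ≺ c → a ≺ c
≺-trans = <-transitive isEquivalence (resp₂ _<_) <-trans

lcp-≺-⊓ : ∀ {a b c} → a ≺ b → b ≺ c → lcp a c ≡ lcp a b ⊓ lcp b c
lcp-≺-⊓ (lex-base ()) _
lcp-≺-⊓ halt _ = refl
lcp-≺-⊓ {x ∷ xs} {y ∷ ys} {z ∷ zs} (this x<y) (this y<z)
  rewrite lcp-∷-< xs zs (<-trans x<y y<z) | lcp-∷-< xs ys x<y = refl
lcp-≺-⊓ {x ∷ xs} {y ∷ ys} {.y ∷ zs} (this x<y) (next refl _)
  rewrite lcp-∷-< xs zs x<y | lcp-∷-< xs ys x<y = refl
lcp-≺-⊓ {x ∷ xs} {.x ∷ ys} {z ∷ zs} (next refl _) (this y<z)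
  rewrite lcp-∷-< xs zs y<z | lcp-∷-< ys zs y<z = sym (⊓-zeroʳ (lcp (x ∷ xs) (x ∷ ys)))
lcp-≺-⊓ {x ∷ xs} {.x ∷ ys} {.x ∷ zs} (next refl p) (next refl q)
  rewrite lcp-∷-≡ x xs zs | lcp-∷-≡ x xs ys | lcp-∷-≡ x ys zs = cong suc (lcp-≺-⊓ p q)

AllPairs-++⁻ : ∀ {A : Set} {R : A → A → Set} xs {ys} → AllPairs R (xs ++ ys) →
               AllPairs R xs × All (λ x → All (R x) ys) xs × AllPairs R ys
AllPairs-++⁻ []       rys         = [] , [] , rys
AllPairs-++⁻ (x ∷ xs) (rx ∷ rxys) with AllPairs-++⁻ xs rxys
... | rxs , rxsys , rys = (++⁻ˡ xs rx ∷ rxs) , (++⁻ʳ xs rx ∷ rxsys) , rys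

-- β and α are the lcps of the node's suffix with those at cra and at cla (0 if absent)
data MaxLcp : Dir → ℕ → ℕ → ℕ → Set where
  towards-cla : ∀ {m β α} → m ≡ α → β ≤ m → MaxLcp left m β α
  towards-cra : ∀ {m β α} → m ≡ β → α ≤ m → MaxLcp right m β α
  neither     : ∀ {β α} → β ≡ 0 → α ≡ 0 → MaxLcp ⊥d 0 β α

lcpWithCra : Dir → ℕ → ℕ → ℕ
lcpWithCra left m g = m ⊓ g
lcpWithCra _    m g = m

lcpWithCla : Dir → ℕ → ℕ → ℕ
lcpWithCla right m g = m ⊓ g
lcpWithCla _     m g = m

MaxLcp⇒lcpWith : ∀ {d m β α} → MaxLcp d m β α →
                 lcpWithCra d m (β ⊓ α) ≡ β × lcpWithCla d m (β ⊓ α) ≡ α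
MaxLcp⇒lcpWith {β = β} {α} (towards-cla refl β≤α) =
  (begin α ⊓ (β ⊓ α) ≡⟨ cong (α ⊓_) (m≤n⇒m⊓n≡m β≤α) ⟩ α ⊓ β ≡⟨ m≥n⇒m⊓n≡n β≤α ⟩ β ∎) , refl
  where open ≡-Reasoning
MaxLcp⇒lcpWith {β = β} {α} (towards-cra refl α≤β) =
  refl , (begin β ⊓ (β ⊓ α) ≡⟨ cong (β ⊓_) (m≥n⇒m⊓n≡n α≤β) ⟩ β ⊓ α ≡⟨ m≥n⇒m⊓n≡n α≤β ⟩ α ∎)
  where open ≡-Reasoning
MaxLcp⇒lcpWith (neither refl refl) = refl , refl

sweep : Tree → ℕ → List ℕ × ℕ
sweep leaf g = [] , g
sweep (node l p d m r) g =
  let (outˡ , gₚ) = sweep l (lcpWithCra d m g)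
      (outʳ , g′) = sweep r (lcpWithCla d m g)
  in outˡ ++ gₚ ∷ outʳ , g′

module _ (T : Text) where

  lcpAt : Maybe ℕ → Maybe ℕ → ℕ
  lcpAt (just a) (just b) = lcp (suf T a) (suf T b)
  lcpAt _        _        = 0

  slcpAfter : Maybe ℕ → List ℕ → List ℕ
  slcpAfter prev []       = []
  slcpAfter prev (q ∷ qs) = lcpAt prev (just q) ∷ slcpAfter (just q) qs

  lastOr : Maybe ℕ → List ℕ → Maybe ℕ
  lastOr p []       = p
  lastOr p (q ∷ qs) = lastOr (just q) qs

  slcpAfter-++-∷ : ∀ p xs q ys →
    slcpAfter p (xs ++ q ∷ ys) ≡ slcpAfter p xs ++ lcpAt (lastOr p xs) (just q) ∷ slcpAfter (just q) ys
  slcpAfter-++-∷ p []       q ys = refl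
  slcpAfter-++-∷ p (x ∷ xs) q ys = cong (lcpAt p (just x) ∷_) (slcpAfter-++-∷ (just x) xs q ys)

  lastOr-++-∷ : ∀ p xs q ys → lastOr p (xs ++ q ∷ ys) ≡ lastOr (just q) ys
  lastOr-++-∷ p []       q ys = refl
  lastOr-++-∷ p (x ∷ xs) q ys = lastOr-++-∷ (just x) xs q ys

  slcpFrom≡slcpAfter : ∀ p xs → slcpFrom T p xs ≡ slcpAfter (just p) xs
  slcpFrom≡slcpAfter p []       = refl
  slcpFrom≡slcpAfter p (x ∷ xs) = cong (_ ∷_) (slcpFrom≡slcpAfter x xs)

  slcpOf≡slcpAfter : ∀ xs → slcpOf T xs ≡ slcpAfter nothing xs
  slcpOf≡slcpAfter []       = refl
  slcpOf≡slcpAfter (x ∷ xs) = cong (0 ∷_) (slcpFrom≡slcpAfter x xs)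

  _≺ₛ_ : ℕ → ℕ → Set
  p ≺ₛ q = suf T p ≺ suf T q

  Above : Maybe ℕ → ℕ → Set
  Above nothing  x = ⊤
  Above (just a) x = a ≺ₛ x

  Below : ℕ → Maybe ℕ → Set
  Below x nothing  = ⊤
  Below x (just b) = x ≺ₛ b

  Between : Maybe ℕ → Maybe ℕ → ℕ → Set
  Between cra cla x = Above cra x × Below x cla

  lcpAt-between : ∀ {cra p cla} → Between cra cla p →
                  lcpAt cra cla ≡ lcpAt cra (just p) ⊓ lcpAt (just p) cla
  lcpAt-between {just b} {p} {just a} (b≺p , p≺a) = lcp-≺-⊓ b≺p p≺a
  lcpAt-between {just b} {p} {nothing} _ = sym (⊓-zeroʳ (lcp (suf T b) (suf T p)))
  lcpAt-between {nothing} _ = refl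

  lcpAt-cra≤ : ∀ {p cla cra d m} → Annot T p cla cra d m → lcpAt cra (just p) ≤ m
  lcpAt-cra≤ {cra = nothing} _ = z≤n
  lcpAt-cra≤ {p} {cra = just b} (_ , maximal) =
    subst (_≤ _) (lcp-comm (suf T p) (suf T b)) (maximal right _ optRight)

  lcpAt-cla≤ : ∀ {p cla cra d m} → Annot T p cla cra d m → lcpAt (just p) cla ≤ m
  lcpAt-cla≤ {cla = nothing} _ = z≤n
  lcpAt-cla≤ {cla = just a} (_ , maximal) = maximal left _ optLeft

  Annot⇒MaxLcp : ∀ {p cla cra d m} → Annot T p cla cra d m →
                 MaxLcp d m (lcpAt cra (just p)) (lcpAt (just p) cla)
  Annot⇒MaxLcp ann@(optLeft , _) = towards-cla refl (lcpAt-cra≤ ann)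
  Annot⇒MaxLcp {p} ann@(optRight {a = b} , _) =
    towards-cra (lcp-comm (suf T p) (suf T b)) (lcpAt-cla≤ ann)
  Annot⇒MaxLcp ann@(optNone , _) = neither (n≤0⇒n≡0 (lcpAt-cra≤ ann)) (n≤0⇒n≡0 (lcpAt-cla≤ ann))

  sweep-slcpAfter : ∀ t {cla cra} → AnnOK T cla cra t → AllPairs _≺ₛ_ (inorder t) →
                    All (Between cra cla) (inorder t) →
                    sweep t (lcpAt cra cla) ≡ (slcpAfter cra (inorder t) , lcpAt (lastOr cra (inorder t)) cla)
  sweep-slcpAfter leaf _ _ _ = refl
  sweep-slcpAfter (node l p d m r) {cla} {cra} (ann , okl , okr) sorted between
    with AllPairs-++⁻ (inorder l) sorted | ++⁻ʳ (inorder l) between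
  ... | sortedˡ , l≺pr , p≺r ∷ sortedʳ | p-between ∷ r-between
    with MaxLcp⇒lcpWith (Annot⇒MaxLcp ann)
  ... | withCra , withCla
    rewrite lcpAt-between p-between | withCra | withCla
          | sweep-slcpAfter l okl sortedˡ
              (All.zipWith (λ (x-between , x≺pr) → proj₁ x-between , All.head x≺pr)
                 (++⁻ˡ (inorder l) between , l≺pr))
          | sweep-slcpAfter r okr sortedʳ
              (All.zipWith (λ (p≺x , x-between) → p≺x , proj₂ x-between) (p≺r , r-between))
          | slcpAfter-++-∷ cra (inorder l) p (inorder r)
          | lastOr-++-∷ cra (inorder l) p (inorder r)
    = refl

  sweep≡SLCP : ∀ t → IsSAVL T t → proj₁ (sweep t 0) ≡ SLCP T t
  sweep≡SLCP t (_ , linked , ok) = begin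
    proj₁ (sweep t 0)
      ≡⟨ cong proj₁ (sweep-slcpAfter t ok (Linked⇒AllPairs ≺-trans linked)
                                         (All.universal (λ _ → tt , tt) (inorder t))) ⟩
    slcpAfter nothing (inorder t)
      ≡⟨ sym (slcpOf≡slcpAfter (inorder t)) ⟩
    SLCP T t ∎
    where open ≡-Reasoning

≡ᵇ-refl : ∀ n → (n ≡ᵇ n) ≡ true
≡ᵇ-refl zero    = refl
≡ᵇ-refl (suc n) = ≡ᵇ-refl n

≢⇒≡ᵇ≡false : ∀ {m n} → m ≢ n → (m ≡ᵇ n) ≡ false
≢⇒≡ᵇ≡false {zero}  {zero}  m≢n = contradiction refl m≢n
≢⇒≡ᵇ≡false {zero}  {suc n} _   = refl
≢⇒≡ᵇ≡false {suc m} {zero}  _   = refl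
≢⇒≡ᵇ≡false {suc m} {suc n} m≢n = ≢⇒≡ᵇ≡false (m≢n ∘ cong suc)

upd-same : ∀ M a v → upd M a v a ≡ v
upd-same M a v rewrite ≡ᵇ-refl a = refl

upd-other : ∀ M a v {x} → x ≢ a → upd M a v x ≡ M x
upd-other M a v x≢a rewrite ≢⇒≡ᵇ≡false x≢a = refl

upd-cong : ∀ {M M′ : Memory} → M ≗ M′ → ∀ {a a′ v v′} → a ≡ a′ → v ≡ v′ → upd M a v ≗ upd M′ a′ v′
upd-cong M≗M′ {a} refl refl x with x ≡ᵇ a
... | true  = refl
... | false = M≗M′ x

upd-self : ∀ {M : Memory} r {v} → M r ≡ v → M ≗ upd M r v
upd-self {M} r {v} Mr≡v x with x ≡ᵇ r in x≡ᵇr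
... | true  rewrite ≡ᵇ⇒≡ x r (subst T (sym x≡ᵇr) _) = Mr≡v
... | false = refl

-- Pinning registers to their known values lets the straight-line code that follows run by computation.
infixl 5 _▷_≔_
_▷_≔_ : ∀ {M M′ : Memory} → M ≗ M′ → ∀ r {v} → M′ r ≡ v → M ≗ upd M′ r v
(M≗M′ ▷ r ≔ M′r≡v) x = trans (M≗M′ x) (upd-self r M′r≡v x)

run-cong : ∀ P k pc {M M′ : Memory} o → M ≗ M′ → run P k pc M o ≡ run P k pc M′ o
run-cong P zero    pc o M≗M′ = refl
run-cong P (suc k) pc {M} {M′} o M≗M′ with fetch P pc
... | const r c   = run-cong P k _ o (upd-cong M≗M′ refl refl)
... | add r a b   = run-cong P k _ o (upd-cong M≗M′ refl (cong₂ _+_ (M≗M′ a) (M≗M′ b)))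
... | sub r a b   = run-cong P k _ o (upd-cong M≗M′ refl (cong₂ _∸_ (M≗M′ a) (M≗M′ b)))
... | load r a    = run-cong P k _ o (upd-cong M≗M′ refl (trans (M≗M′ (M a)) (cong M′ (M≗M′ a))))
... | store a r   = run-cong P k _ o (upd-cong M≗M′ (M≗M′ a) (M≗M′ r))
... | jmpz r l rewrite M≗M′ r = run-cong P k _ o M≗M′
... | jmp l       = run-cong P k _ o M≗M′
... | out r rewrite M≗M′ r = run-cong P k _ _ M≗M′
... | halt        = refl

run-jmpz : ∀ P pc {r l} M o k → fetch P pc ≡ jmpz r l →
           run P (suc k) pc M o ≡ run P k (if M r ≡ᵇ 0 then l else suc pc) M o
run-jmpz P pc M o k fetch≡ with fetch P pc
run-jmpz P pc M o k refl | _ = refl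

-- Registers: M[0] stack pointer, M[1] = 16 + E where E = 8m, M[2] current node, M[3] current g,
-- M[4] … M[13] scratch. Input cell x is copied to 16 + E + x, and the stack of (right child, g)
-- pairs grows from 16 + E + 16 + E.
prog : Program
prog =
  -- 0–17: halt on an empty tree; save the root index at 16 + E and cells 2–4 at 16 + E + 2, …
  jmpz 0 82 ∷ add 0 0 0 ∷ add 0 0 0 ∷ add 0 0 0 ∷
  store 0 1 ∷ const 1 16 ∷ add 1 1 0 ∷ load 0 0 ∷ store 1 0 ∷
  const 0 2 ∷ add 0 1 0 ∷ store 0 2 ∷
  const 0 3 ∷ add 0 1 0 ∷ store 0 3 ∷
  const 0 4 ∷ add 0 1 0 ∷ store 0 4 ∷
  -- 18–26: copy cells 5 … 15 + E to 16 + E + 5, …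
  const 2 5 ∷ sub 3 1 2 ∷ jmpz 3 27 ∷ add 3 1 2 ∷ load 4 2 ∷ store 3 4 ∷ const 4 1 ∷ add 2 2 4 ∷ jmp 19 ∷
  -- 27–29: stack pointer := 16 + E + 16 + E, current node := root, g := 0
  add 0 1 1 ∷ load 2 1 ∷ const 3 0 ∷
  -- 30–56: unless at an empty subtree, read the node's m_v, d_v, right child and left child
  jmpz 2 72 ∷
  add 4 2 2 ∷ add 4 4 4 ∷ add 4 4 2 ∷ const 5 3 ∷ sub 4 4 5 ∷
  const 5 4 ∷ add 5 4 5 ∷ add 5 1 5 ∷ load 6 5 ∷
  const 5 3 ∷ add 5 4 5 ∷ add 5 1 5 ∷ load 7 5 ∷
  const 5 2 ∷ add 5 4 5 ∷ add 5 1 5 ∷ load 8 5 ∷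
  const 5 1 ∷ add 5 4 5 ∷ add 5 1 5 ∷ load 2 5 ∷
  sub 9 6 3 ∷ sub 9 6 9 ∷ const 13 0 ∷ add 10 6 13 ∷ add 11 6 13 ∷
  -- 57–63: M[10] := lcpWithCla d_v m_v g, M[11] := lcpWithCra d_v m_v g
  jmpz 7 64 ∷ const 12 1 ∷ sub 12 7 12 ∷ jmpz 12 63 ∷ add 10 9 13 ∷ jmp 64 ∷ add 11 9 13 ∷
  -- 64–71: push (right child, M[10]); g := M[11]; descend to the left child
  store 0 8 ∷ const 5 1 ∷ add 5 0 5 ∷ store 5 10 ∷ const 5 2 ∷ add 0 0 5 ∷ add 3 11 13 ∷ jmp 30 ∷
  -- 72–81: halt if the stack is empty, else output g and pop (node, g)
  add 4 1 1 ∷ sub 4 0 4 ∷ jmpz 4 82 ∷ out 3 ∷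
  const 5 1 ∷ sub 0 0 5 ∷ load 3 0 ∷ sub 0 0 5 ∷ load 2 0 ∷ jmp 30 ∷
  halt ∷ []

record Conf : Set where
  constructor ⟨_,_,_⟩
  field
    pc  : ℕ
    mem : Memory
    rev-out : List ℕ

infix 4 _⟶⟨_⟩_
record _⟶⟨_⟩_ (c : Conf) (n : ℕ) (c′ : Conf) : Set where
  constructor steps
  open Conf
  field
    run-steps : ∀ k → run prog (n + k) (pc c) (mem c) (rev-out c) ≡ run prog k (pc c′) (mem c′) (rev-out c′)
open _⟶⟨_⟩_

infixr 5 _⨾_
_⨾_ : ∀ {c c′ c″ n n′} → c ⟶⟨ n ⟩ c′ → c′ ⟶⟨ n′ ⟩ c″ → c ⟶⟨ n + n′ ⟩ c″
_⨾_ {⟨ pc , M , o ⟩} {n = n} {n′} s s′ =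
  steps λ k → trans (cong (λ j → run prog j pc M o) (+-assoc n n′ k))
                    (trans (run-steps s (n′ + k)) (run-steps s′ k))

≗-steps : ∀ {pc o} {M M′ : Memory} → M ≗ M′ → ⟨ pc , M , o ⟩ ⟶⟨ 0 ⟩ ⟨ pc , M′ , o ⟩
≗-steps {pc} {o} M≗M′ = steps λ k → run-cong prog k pc o M≗M′

jmpz-steps : ∀ pc {r l M o b} → fetch prog pc ≡ jmpz r l → (M r ≡ᵇ 0) ≡ b →
             ⟨ pc , M , o ⟩ ⟶⟨ 1 ⟩ ⟨ if b then l else suc pc , M , o ⟩
jmpz-steps pc {M = M} {o} fetch≡ refl = steps λ k → run-jmpz prog pc M o k fetch≡

computed : ∀ {pc M o} n pc′ M′ o′ → (∀ k → run prog (n + k) pc M o ≡ run prog k pc′ M′ o′) →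
           ⟨ pc , M , o ⟩ ⟶⟨ n ⟩ ⟨ pc′ , M′ , o′ ⟩
computed _ _ _ _ = steps

recount : ∀ {c c′ n n′} → n ≡ n′ → c ⟶⟨ n ⟩ c′ → c ⟶⟨ n′ ⟩ c′
recount refl s = s

cast-out : ∀ {c n pc M o o′} → o ≡ o′ → c ⟶⟨ n ⟩ ⟨ pc , M , o ⟩ → c ⟶⟨ n ⟩ ⟨ pc , M , o′ ⟩
cast-out refl s = s

slice : ℕ → ℕ → List Instr
slice from to = take (to ∸ from) (drop from prog)

exec : List Instr → Memory → Memory
exec []               M = M
exec (const r c ∷ is) M = exec is (upd M r c)
exec (add r a b ∷ is) M = exec is (upd M r (M a + M b))
exec (sub r a b ∷ is) M = exec is (upd M r (M a ∸ M b))
exec (load r a ∷ is)  M = exec is (upd M r (M (M a)))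
exec (store a r ∷ is) M = exec is (upd M (M a) (M r))
exec (_ ∷ is)         M = exec is M

m∸[m∸n]≡m⊓n : ∀ m n → m ∸ (m ∸ n) ≡ m ⊓ n
m∸[m∸n]≡m⊓n m n with ≤-total n m
... | inj₁ n≤m = trans (m∸[m∸n]≡n n≤m) (sym (m≥n⇒m⊓n≡n n≤m))
... | inj₂ m≤n rewrite m≤n⇒m∸n≡0 m≤n = sym (m≤n⇒m⊓n≡m m≤n)

-- base i, computed as the program does
base′ : ℕ → ℕ
base′ i = ((i + i) + (i + i)) + i ∸ 3

shifted : ℕ → Memory → Memory
shifted E M x = M (16 + (E + x))

record Descended (M : Memory) (o : List ℕ) (s E li ri gˡ gʳ : ℕ) : Set where
  field
    mem′        : Memory
    cost        : ℕ
    cost≤       : cost ≤ 41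
    run-descend : ⟨ 30 , M , o ⟩ ⟶⟨ cost ⟩ ⟨ 30 , mem′ , o ⟩
    sp          : mem′ 0 ≡ 16 + (s + 2)
    copy-base   : mem′ 1 ≡ 16 + E
    current     : mem′ 2 ≡ li
    current-g   : mem′ 3 ≡ gˡ
    pushed-node : mem′ (16 + s) ≡ ri
    pushed-g    : mem′ (16 + (s + 1)) ≡ gʳ
    unchanged   : ∀ y → y < s → mem′ (16 + y) ≡ M (16 + y)

record ReadyToPush (M : Memory) (o : List ℕ) (s E li ri gˡ gʳ : ℕ) : Set where
  field
    mem′       : Memory
    cost       : ℕ
    cost≤      : cost ≤ 33
    run-read   : ⟨ 30 , M , o ⟩ ⟶⟨ cost ⟩ ⟨ 64 , mem′ , o ⟩
    sp         : mem′ 0 ≡ 16 + s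
    copy-base  : mem′ 1 ≡ 16 + E
    current    : mem′ 2 ≡ li
    right-node : mem′ 8 ≡ ri
    right-g    : mem′ 10 ≡ gʳ
    left-g     : mem′ 11 ≡ gˡ
    zero₁₃     : mem′ 13 ≡ 0
    unchanged  : ∀ y → mem′ (16 + y) ≡ M (16 + y)

push : ∀ {M o s E li ri gˡ gʳ} → ReadyToPush M o s E li ri gˡ gʳ → Descended M o s E li ri gˡ gʳ
push {M} {o} {s} {E} {li} {ri} {gˡ} {gʳ} ready = record
  { mem′        = pushed
  ; cost        = cost + 8
  ; cost≤       = +-monoˡ-≤ 8 cost≤
  ; run-descend = run-read ⨾ ≗-steps (upd-self 0 sp) ⨾ computed 8 30 pushed o (λ _ → refl)
  ; sp          = refl
  ; copy-base   = copy-base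
  ; current     = current
  ; current-g   = trans (cong₂ _+_ left-g zero₁₃) (+-identityʳ gˡ)
  ; pushed-node = pushed-node
  ; pushed-g    = pushed-g
  ; unchanged   = pushed-unchanged
  }
  where
  open ReadyToPush ready
  pushed : Memory
  pushed = exec (slice 64 71) (upd mem′ 0 (16 + s))
  pushed-node : pushed (16 + s) ≡ ri
  pushed-node rewrite ≢⇒≡ᵇ≡false (m+1+n≢m s {0} ∘ sym) | ≡ᵇ-refl s = right-node
  pushed-g : pushed (16 + (s + 1)) ≡ gʳ
  pushed-g rewrite ≡ᵇ-refl (s + 1) = right-g
  pushed-unchanged : ∀ y → y < s → pushed (16 + y) ≡ M (16 + y)
  pushed-unchanged y y<s
    rewrite ≢⇒≡ᵇ≡false (<⇒≢ (<-trans y<s (m<m+n s {1} z<s))) | ≢⇒≡ᵇ≡false (<⇒≢ y<s) = unchanged y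

module ReadNode (M : Memory) (o : List ℕ) {s E i′ g li ri mv : ℕ}
  (M0 : M 0 ≡ 16 + s) (M1 : M 1 ≡ 16 + E) (M2 : M 2 ≡ suc i′) (M3 : M 3 ≡ g)
  (left-child : shifted E M (base′ (suc i′) + 1) ≡ li) (right-child : shifted E M (base′ (suc i′) + 2) ≡ ri)
  (stored-m : shifted E M (base′ (suc i′) + 4) ≡ mv) where

  private
    opaque
      after-read : Memory
      after-read =
        exec (slice 31 57) (upd (upd (upd (upd M 0 (16 + s)) 1 (16 + E)) 2 (suc i′)) 3 g)

    opaque
      unfolding after-read
      read-node : ⟨ 30 , M , o ⟩ ⟶⟨ 27 ⟩ ⟨ 57 , after-read , o ⟩
      read-node = ≗-steps (upd-self 0 M0 ▷ 1 ≔ M1 ▷ 2 ≔ M2 ▷ 3 ≔ M3) ⨾ steps λ _ → refl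

      read-min : after-read 9 ≡ mv ⊓ g
      read-min rewrite stored-m = m∸[m∸n]≡m⊓n mv g

      read-m : after-read 10 ≡ mv × after-read 11 ≡ mv
      read-m rewrite stored-m = +-identityʳ mv , +-identityʳ mv

      read-d : after-read 7 ≡ shifted E M (base′ (suc i′) + 3)
      read-d = refl

      read-registers : after-read 0 ≡ 16 + s × after-read 1 ≡ 16 + E × after-read 2 ≡ li
                       × after-read 8 ≡ ri × after-read 13 ≡ 0
      read-registers = refl , refl , left-child , right-child , refl

      read-unchanged : ∀ y → after-read (16 + y) ≡ M (16 + y)
      read-unchanged y = refl

    after-test : Memory
    after-test = exec (slice 58 60) after-read

    after-choice : ℕ → Memory
    after-choice pc = exec (slice pc (suc pc)) after-test

    ready-at : ∀ {gˡ gʳ} X n → n ≤ 33 → ⟨ 30 , M , o ⟩ ⟶⟨ n ⟩ ⟨ 64 , X , o ⟩ → X 10 ≡ gʳ → X 11 ≡ gˡ →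
               X 0 ≡ 16 + s × X 1 ≡ 16 + E × X 2 ≡ li × X 8 ≡ ri × X 13 ≡ 0 →
               (∀ y → X (16 + y) ≡ M (16 + y)) → ReadyToPush M o s E li ri gˡ gʳ
    ready-at X n n≤33 run X10 X11 (X0 , X1 , X2 , X8 , X13) unchanged =
      record { mem′ = X ; cost = n ; cost≤ = n≤33 ; run-read = run ; sp = X0 ; copy-base = X1
             ; current = X2 ; right-node = X8 ; right-g = X10 ; left-g = X11 ; zero₁₃ = X13 ; unchanged = unchanged }

    read-min+0 : after-read 9 + after-read 13 ≡ mv ⊓ g
    read-min+0 = trans (cong₂ _+_ read-min (read-registers .proj₂ .proj₂ .proj₂ .proj₂)) (+-identityʳ _)

  read-and-choose : ∀ d → shifted E M (base′ (suc i′) + 3) ≡ dcode d →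
                    ReadyToPush M o s E li ri (lcpWithCra d mv g) (lcpWithCla d mv g)
  read-and-choose ⊥d d≡ =
    ready-at after-read 28 (m≤m+n 28 5) (read-node ⨾ jmpz-steps 57 refl (cong (_≡ᵇ 0) (trans read-d d≡)))
      (read-m .proj₁) (read-m .proj₂) read-registers read-unchanged
  read-and-choose left d≡ =
    ready-at (after-choice 63) 32 (m≤m+n 32 1)
      (read-node ⨾ jmpz-steps 57 refl (cong (_≡ᵇ 0) (trans read-d d≡)) ⨾ computed 2 60 after-test o (λ _ → refl)
        ⨾ jmpz-steps 60 refl (cong (λ c → c ∸ 1 ≡ᵇ 0) (trans read-d d≡)) ⨾ computed 1 64 (after-choice 63) o (λ _ → refl))
      (read-m .proj₁) read-min+0 read-registers read-unchanged
  read-and-choose right d≡ =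
    ready-at (after-choice 61) 33 ≤-refl
      (read-node ⨾ jmpz-steps 57 refl (cong (_≡ᵇ 0) (trans read-d d≡)) ⨾ computed 2 60 after-test o (λ _ → refl)
        ⨾ jmpz-steps 60 refl (cong (λ c → c ∸ 1 ≡ᵇ 0) (trans read-d d≡)) ⨾ computed 2 64 (after-choice 61) o (λ _ → refl))
      read-min+0 (read-m .proj₂) read-registers read-unchanged

open ReadNode using (read-and-choose)

record Popped (M : Memory) (s E x : ℕ) : Set where
  field
    mem′      : Memory
    run-pop   : ∀ o → ⟨ 72 , M , o ⟩ ⟶⟨ 10 ⟩ ⟨ 30 , mem′ , x ∷ o ⟩
    sp        : mem′ 0 ≡ 16 + s
    copy-base : mem′ 1 ≡ 16 + E
    current   : mem′ 2 ≡ M (16 + s)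
    current-g : mem′ 3 ≡ M (16 + (s + 1))
    unchanged : ∀ y → mem′ (16 + y) ≡ M (16 + y)

opaque
  pop : ∀ {M s E x} → E + (16 + E) ≤ s → M 0 ≡ 16 + (s + 2) → M 1 ≡ 16 + E → M 3 ≡ x → Popped M s E x
  pop {M} {s} {E} {x} nonempty M0 M1 M3 = record
    { mem′      = popped
    ; run-pop   = λ o → ≗-steps (upd-self 0 M0 ▷ 1 ≔ M1 ▷ 3 ≔ M3)
                      ⨾ computed 2 74 tested o (λ _ → refl)
                      ⨾ jmpz-steps 74 refl stack-nonempty
                      ⨾ computed 7 30 popped (x ∷ o) (λ _ → refl)
    ; sp        = cong (14 +_) (+-comm s 2)
    ; copy-base = refl
    ; current   = cong (λ y → M (14 + y)) (+-comm s 2)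
    ; current-g = cong (λ y → M (15 + y)) (+-suc s 1)
    ; unchanged = λ _ → refl
    }
    where
    tested : Memory
    tested = exec (slice 72 74) (upd (upd (upd M 0 (16 + (s + 2))) 1 (16 + E)) 3 x)
    stack-nonempty : ((s + 2) ∸ (E + (16 + E)) ≡ᵇ 0) ≡ false
    stack-nonempty rewrite +-∸-comm 2 nonempty | +-comm (s ∸ (E + (16 + E))) 2 = refl
    popped : Memory
    popped = exec (slice 76 81) tested

base′≡base : ∀ i → base′ i ≡ base i
base′≡base i = cong (_∸ 3) (solve 1 (λ i → ((i :+ i) :+ (i :+ i)) :+ i := con 5 :* i) refl i)

base-suc : ∀ i → base (suc i) ≡ 2 + 5 * i
base-suc i = cong (_∸ 3) (*-suc 5 i)

last-field< : ∀ {i m} → suc i ≤ m → base (suc i) + 4 < 5 * m + 2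
last-field< {i} {m} i<m = begin-strict
  base (suc i) + 4     ≡⟨ cong (_+ 4) (base-suc i) ⟩
  2 + 5 * i + 4        <⟨ n<1+n _ ⟩
  suc (2 + 5 * i + 4)  ≡⟨ solve 1 (λ i → con 1 :+ (con 2 :+ con 5 :* i :+ con 4) := con 5 :* (con 1 :+ i) :+ con 2) refl i ⟩
  5 * suc i + 2        ≤⟨ +-monoˡ-≤ 2 (*-monoʳ-≤ 5 i<m) ⟩
  5 * m + 2            ∎
  where open ≤-Reasoning

RepAt-cong : ∀ {M M′ : Memory} {m} → (∀ x → 2 ≤ x → x < 5 * m + 2 → M′ x ≡ M x) →
             ∀ {i} t → RepAt M m i t → RepAt M′ m i t
RepAt-cong agree leaf i≡0 = i≡0
RepAt-cong {M} {M′} {m} agree {suc i} (node l p d mv r) (1≤i , i<m , pos , repˡ , repʳ , dir , stored) =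
  1≤i , i<m , trans (agree-at ≤-refl (m≤m+n _ 4)) pos ,
  child 1 (s≤s z≤n) l repˡ , child 2 (s≤s (s≤s z≤n)) r repʳ ,
  trans (agree-field 3 (s≤s (s≤s (s≤s z≤n)))) dir , trans (agree-field 4 ≤-refl) stored
  where
  agree-at : ∀ {x} → base (suc i) ≤ x → x ≤ base (suc i) + 4 → M′ x ≡ M x
  agree-at {x} lo hi = agree x (≤-trans (m≤m+n 2 (5 * i)) (subst (_≤ x) (base-suc i) lo))
                               (≤-<-trans hi (last-field< i<m))
  agree-field : ∀ f → f ≤ 4 → M′ (base (suc i) + f) ≡ M (base (suc i) + f)
  agree-field f f≤4 = agree-at (m≤m+n _ f) (+-monoʳ-≤ _ f≤4)
  child : ∀ f → f ≤ 4 → ∀ t → RepAt M m (M (base (suc i) + f)) t → RepAt M′ m (M′ (base (suc i) + f)) t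
  child f f≤4 t rep = subst (λ c → RepAt M′ m c t) (sym (agree-field f f≤4)) (RepAt-cong agree t rep)

reverse-++-∷ : ∀ (xs : List ℕ) x ys zs → reverse (xs ++ x ∷ ys) ++ zs ≡ reverse ys ++ x ∷ (reverse xs ++ zs)
reverse-++-∷ xs x ys zs = begin
  reverse (xs ++ x ∷ ys) ++ zs               ≡⟨ cong (_++ zs) (reverse-++ xs (x ∷ ys)) ⟩
  (reverse (x ∷ ys) ++ reverse xs) ++ zs     ≡⟨ cong (λ w → (w ++ reverse xs) ++ zs) (unfold-reverse x ys) ⟩
  ((reverse ys ++ x ∷ []) ++ reverse xs) ++ zs ≡⟨ ++-assoc (reverse ys ++ x ∷ []) (reverse xs) zs ⟩
  (reverse ys ++ x ∷ []) ++ (reverse xs ++ zs) ≡⟨ ++-assoc (reverse ys) (x ∷ []) _ ⟩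
  reverse ys ++ x ∷ (reverse xs ++ zs)       ∎
  where open ≡-Reasoning

module Walk (E m : ℕ) (copy-fits : 5 * m + 2 ≤ 16 + E) where

  StackAbove : ℕ → Set
  StackAbove s = E + (16 + E) ≤ s

  Unchanged : Memory → Memory → ℕ → Set
  Unchanged M M′ s = ∀ y → y < s → M′ (16 + y) ≡ M (16 + y)

  keeps-tree : ∀ {M M′ s} → StackAbove s → Unchanged M M′ s →
               ∀ {i} t → RepAt (shifted E M) m i t → RepAt (shifted E M′) m i t
  keeps-tree stack unchanged = RepAt-cong λ x _ x< →
    unchanged (E + x) (<-≤-trans (+-monoʳ-< E (<-≤-trans x< copy-fits)) stack)

  record Visited (M : Memory) (o : List ℕ) (s : ℕ) (t : Tree) (g : ℕ) : Set where
    field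
      mem′      : Memory
      cost      : ℕ
      cost≤     : cost ≤ 52 * size t + 1
      run-visit : ⟨ 30 , M , o ⟩ ⟶⟨ cost ⟩ ⟨ 72 , mem′ , reverse (proj₁ (sweep t g)) ++ o ⟩
      sp        : mem′ 0 ≡ 16 + s
      copy-base : mem′ 1 ≡ 16 + E
      final-g   : mem′ 3 ≡ proj₂ (sweep t g)
      unchanged : Unchanged M mem′ s

  visit-cost : ∀ {a b e} c d → a ≤ 41 → b ≤ 52 * c + 1 → e ≤ 52 * d + 1 →
               a + (b + (10 + e)) ≤ 52 * suc (c + d) + 1
  visit-cost {a} {b} {e} c d a≤ b≤ e≤ = begin
    a + (b + (10 + e))                             ≤⟨ +-mono-≤ a≤ (+-mono-≤ b≤ (+-monoʳ-≤ 10 e≤)) ⟩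
    41 + ((52 * c + 1) + (10 + (52 * d + 1)))      ≡⟨ solve 2 (λ c d → con 41 :+ ((con 52 :* c :+ con 1) :+ (con 10 :+ (con 52 :* d :+ con 1)))
                                                               := con 52 :* (con 1 :+ (c :+ d)) :+ con 1) refl c d ⟩
    52 * suc (c + d) + 1                           ∎
    where open ≤-Reasoning

  visit : ∀ t {i g s M} o → StackAbove s → M 0 ≡ 16 + s → M 1 ≡ 16 + E → M 2 ≡ i → M 3 ≡ g →
          RepAt (shifted E M) m i t → Visited M o s t g
  visit leaf {M = M} o _ M0 M1 M2 M3 refl = record
    { mem′ = M ; cost = 1 ; cost≤ = ≤-refl ; run-visit = jmpz-steps 30 refl (cong (_≡ᵇ 0) M2)
    ; sp = M0 ; copy-base = M1 ; final-g = M3 ; unchanged = λ _ _ → refl }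
  visit (node l p d mv r) {suc i} {g} {s} {M} o stack M0 M1 M2 M3 (_ , _ , _ , repˡ , repʳ , dir , stored) = record
    { mem′      = Visited.mem′ visitʳ
    ; cost      = _
    ; cost≤     = visit-cost (size l) (size r) (Descended.cost≤ down) (Visited.cost≤ visitˡ) (Visited.cost≤ visitʳ)
    ; run-visit = cast-out (sym (reverse-++-∷ (proj₁ (sweep l gˡ)) (proj₂ (sweep l gˡ)) (proj₁ (sweep r gʳ)) o))
                    (Descended.run-descend down ⨾ Visited.run-visit visitˡ ⨾ Popped.run-pop up _ ⨾ Visited.run-visit visitʳ)
    ; sp        = Visited.sp visitʳ
    ; copy-base = Visited.copy-base visitʳ
    ; final-g   = Visited.final-g visitʳ
    ; unchanged = λ y y<s → trans (Visited.unchanged visitʳ y y<s) (unchanged-up y y<s)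
    }
    where
    gˡ gʳ : ℕ
    gˡ = lcpWithCra d mv g
    gʳ = lcpWithCla d mv g
    at-field : ∀ f → shifted E M (base′ (suc i) + f) ≡ shifted E M (base (suc i) + f)
    at-field f = cong (λ b → shifted E M (b + f)) (base′≡base (suc i))
    down : Descended M o s E _ _ gˡ gʳ
    down = push (read-and-choose M o M0 M1 M2 M3 (at-field 1) (at-field 2) (trans (at-field 4) stored) d
                   (trans (at-field 3) dir))
    visitˡ : Visited (Descended.mem′ down) o (s + 2) l gˡ
    visitˡ = visit l o (≤-trans stack (m≤m+n s 2)) (Descended.sp down) (Descended.copy-base down)
               (Descended.current down) (Descended.current-g down)
               (keeps-tree {M} {Descended.mem′ down} stack (Descended.unchanged down) l repˡ)
    up : Popped (Visited.mem′ visitˡ) s E (proj₂ (sweep l gˡ))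
    up = pop stack (Visited.sp visitˡ) (Visited.copy-base visitˡ) (Visited.final-g visitˡ)
    unchanged-up : Unchanged M (Popped.mem′ up) s
    unchanged-up y y<s = trans (Popped.unchanged up y)
      (trans (Visited.unchanged visitˡ y (<-≤-trans y<s (m≤m+n s 2))) (Descended.unchanged down y y<s))
    visitʳ : Visited (Popped.mem′ up) _ s r gʳ
    visitʳ = visit r _ stack (Popped.sp up) (Popped.copy-base up)
               (trans (Popped.current up)
                  (trans (Visited.unchanged visitˡ s (m<m+n s {2} z<s)) (Descended.pushed-node down)))
               (trans (Popped.current-g up)
                  (trans (Visited.unchanged visitˡ (s + 1) (+-monoʳ-< s {1} {2} (s≤s (s≤s z≤n)))) (Descended.pushed-g down)))
               (keeps-tree {M} {Popped.mem′ up} stack unchanged-up r repʳ)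

module Copy (M : Memory) (E : ℕ) where

  Source : Memory → Set
  Source X = ∀ z → 5 + z < E → X (5 + z) ≡ M (5 + z)

  CopiedBelow : ℕ → Memory → Set
  CopiedBelow j X = ∀ x → 2 ≤ x → x < 5 + j → x < E → X (16 + (E + x)) ≡ M x

  record Copied (X : Memory) (c : ℕ) : Set where
    field
      mem′      : Memory
      run-copy  : ⟨ 19 , X , [] ⟩ ⟶⟨ 8 * c + 2 ⟩ ⟨ 27 , mem′ , [] ⟩
      copy-base : mem′ 1 ≡ 16 + E
      copied    : CopiedBelow (11 + E) mem′
      root      : mem′ (16 + E) ≡ M 1

  opaque
    copy : ∀ c {j X} → j + c ≡ 11 + E → X 1 ≡ 16 + E → X 2 ≡ 5 + j →
           Source X → CopiedBelow j X → X (16 + E) ≡ M 1 → Copied X c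
    copy zero {j} {X} j≡ X1 X2 source copied root = record
      { mem′      = tested
      ; run-copy  = ≗-steps (upd-self 1 X1 ▷ 2 ≔ X2) ⨾ computed 1 20 tested [] (λ _ → refl)
                  ⨾ jmpz-steps 20 refl (cong (_≡ᵇ 0) done)
      ; copy-base = refl
      ; copied    = λ x 2≤x x< → copied x 2≤x (subst (λ w → x < 5 + w) (sym j≡11+E) x<)
      ; root      = root
      }
      where
      tested : Memory
      tested = exec (slice 19 20) (upd (upd X 1 (16 + E)) 2 (5 + j))
      j≡11+E : j ≡ 11 + E
      j≡11+E = trans (sym (+-identityʳ j)) j≡
      done : tested 3 ≡ 0
      done rewrite j≡11+E = n∸n≡0 (11 + E)
    copy (suc c) {j} {X} j≡ X1 X2 source copied root = record
      { mem′      = Copied.mem′ rest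
      ; run-copy  = recount (cong (_+ 2) (sym (*-suc 8 c)))
                    (≗-steps (upd-self 1 X1 ▷ 2 ≔ X2) ⨾ computed 1 20 tested [] (λ _ → refl)
                     ⨾ jmpz-steps 20 refl (cong (_≡ᵇ 0) remaining) ⨾ computed 6 19 stepped [] (λ _ → refl)
                     ⨾ Copied.run-copy rest)
      ; copy-base = Copied.copy-base rest
      ; copied    = Copied.copied rest
      ; root      = Copied.root rest
      }
      where
      tested : Memory
      tested = exec (slice 19 20) (upd (upd X 1 (16 + E)) 2 (5 + j))
      stepped : Memory
      stepped = exec (slice 21 26) tested
      remaining : tested 3 ≡ suc c
      remaining = trans (cong (_∸ j) (sym j≡)) (m+n∸m≡n j (suc c))
      target≢ : ∀ {y} → y < 5 + j → 16 + (E + y) ≢ 16 + (E + (5 + j))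
      target≢ y< eq = <⇒≢ y< (+-cancelˡ-≡ E _ _ (+-cancelˡ-≡ 16 _ _ eq))
      source′ : Source stepped
      source′ z z< rewrite ≢⇒≡ᵇ≡false {z} {11 + (E + (5 + j))}
                             (<⇒≢ (<-≤-trans (≤-<-trans (m≤n+m z 5) z<)
                                             (≤-trans (m≤m+n E (5 + j)) (m≤n+m _ 11)))) = source z z<
      copied′ : CopiedBelow (j + 1) stepped
      copied′ x 2≤x x< x<E with m≤n⇒m<n∨m≡n (≤-pred (subst (x <_) (cong (5 +_) (+-comm j 1)) x<))
      ... | inj₁ x<5+j rewrite ≢⇒≡ᵇ≡false (target≢ x<5+j) = copied x 2≤x x<5+j x<E
      ... | inj₂ refl rewrite ≡ᵇ-refl (16 + (E + (5 + j))) = source j x<E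
      root′ : stepped (16 + E) ≡ M 1
      root′ rewrite ≢⇒≡ᵇ≡false {16 + E} {16 + (E + (5 + j))} (m+1+n≢m E ∘ sym ∘ +-cancelˡ-≡ 16 _ _) = root
      rest : Copied stepped c
      rest = copy c (trans (+-assoc j 1 c) j≡) refl refl source′ copied′ root′

finish : ∀ H o {E} → H 0 ≡ 16 + (E + (16 + E)) → H 1 ≡ 16 + E →
         ∀ k → run prog (3 + suc k) 72 H o ≡ just (reverse o)
finish H o {E} H0 H1 k = run-steps halting (suc k)
  where
  tested : Memory
  tested = exec (slice 72 74) (upd (upd H 0 (16 + (E + (16 + E)))) 1 (16 + E))
  halting : ⟨ 72 , H , o ⟩ ⟶⟨ 3 ⟩ ⟨ 82 , tested , o ⟩
  halting = ≗-steps (upd-self 0 H0 ▷ 1 ≔ H1) ⨾ computed 2 74 tested o (λ _ → refl)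
          ⨾ jmpz-steps 74 refl (cong (_≡ᵇ 0) (n∸n≡0 (E + (16 + E))))

save : ℕ → Memory → Memory
save k = exec (const 0 k ∷ add 0 1 0 ∷ store 0 k ∷ [])

save-at : ∀ k X → save (suc k) X (X 1 + suc k) ≡ X (suc k)
save-at k X = upd-same (upd (upd X 0 (suc k)) 0 (X 1 + suc k)) (X 1 + suc k) _

save-other : ∀ k X y → suc y ≢ X 1 + k → save k X (suc y) ≡ X (suc y)
save-other k X y ne = upd-other (upd (upd X 0 k) 0 (X 1 + k)) (X 1 + k) _ ne

module Setup (M : Memory) (m′ : ℕ) (M0 : M 0 ≡ suc m′) where

  -- 8m, in a form that lets comparisons with register numbers compute
  E : ℕ
  E = 8 + 8 * m′

  private
    doubled : Memory
    doubled = exec (slice 1 4) (upd M 0 (suc m′))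

    doubled-0 : doubled 0 ≡ E
    doubled-0 = solve 1 (λ m → let n = con 1 :+ m in ((n :+ n) :+ (n :+ n)) :+ ((n :+ n) :+ (n :+ n))
                                   := con 8 :+ con 8 :* m) refl m′


    scaled : Memory
    scaled = upd doubled 0 E

    registers-set : Memory
    registers-set = exec (slice 5 8) (upd scaled E (M 1))

    root-saved : Memory
    root-saved = upd registers-set (16 + E) (registers-set 0)

    root-saved-root : root-saved (16 + E) ≡ M 1
    root-saved-root = trans (upd-same registers-set (16 + E) _) (upd-same scaled E (M 1))

    root-saved-other : ∀ y → 2 + y ≢ 16 + E → 2 + y ≢ E → root-saved (2 + y) ≡ M (2 + y)
    root-saved-other y ne₁ ne₂ = trans (upd-other registers-set (16 + E) _ ne₁) (upd-other scaled E (M 1) ne₂)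

  entry : Memory
  entry = upd (save 4 (save 3 (save 2 root-saved))) 2 5

  run-entry : ⟨ 0 , M , [] ⟩ ⟶⟨ 19 ⟩ ⟨ 19 , entry , [] ⟩
  run-entry = ≗-steps (upd-self 0 M0) ⨾ computed 4 4 doubled [] (λ _ → refl)
            ⨾ ≗-steps (upd-self 0 doubled-0) ⨾ computed 15 19 entry [] (λ _ → refl)

  private
    under-E : ∀ {y} k → y < E → y ≢ 16 + (E + k)
    under-E {y} k y<E = <⇒≢ (<-≤-trans y<E (≤-trans (m≤m+n E k) (m≤n+m _ 16)))

    beyond-E : ∀ {a b} → a ≢ b → 16 + (E + a) ≢ 16 + (E + b)
    beyond-E a≢b eq = a≢b (+-cancelˡ-≡ E _ _ (+-cancelˡ-≡ 16 _ _ eq))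

    root≢ : ∀ k → 16 + E ≢ 16 + (E + suc k)
    root≢ k eq = m+1+n≢m E (sym (+-cancelˡ-≡ 16 _ _ eq))

    through-saves : ∀ y → 5 + y < E → save 4 (save 3 (save 2 root-saved)) (5 + y) ≡ root-saved (5 + y)
    through-saves y y< =
      trans (save-other 4 (save 3 (save 2 root-saved)) (4 + y) (under-E 4 y<))
        (trans (save-other 3 (save 2 root-saved) (4 + y) (under-E 3 y<))
               (save-other 2 root-saved (4 + y) (under-E 2 y<)))

  entry-root : entry (16 + E) ≡ M 1
  entry-root =
    trans (save-other 4 (save 3 (save 2 root-saved)) (15 + E) (root≢ 3))
      (trans (save-other 3 (save 2 root-saved) (15 + E) (root≢ 2))
        (trans (save-other 2 root-saved (15 + E) (root≢ 1)) root-saved-root))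

  entry-source : Copy.Source M E entry
  entry-source y y<E =
    trans (through-saves y y<E)
      (root-saved-other (3 + y) (<⇒≢ (<-≤-trans y<E (m≤n+m E 16))) (<⇒≢ y<E))

  entry-copied : Copy.CopiedBelow M E 0 entry
  entry-copied 2 _ _ _ =
    trans (save-other 4 (save 3 (save 2 root-saved)) (15 + (E + 2)) (beyond-E λ ()))
      (trans (save-other 3 (save 2 root-saved) (15 + (E + 2)) (beyond-E λ ()))
        (trans (save-at 1 root-saved) (root-saved-other 0 (λ ()) (λ ()))))
  entry-copied 3 _ _ _ =
    trans (save-other 4 (save 3 (save 2 root-saved)) (15 + (E + 3)) (beyond-E λ ()))
      (trans (save-at 2 (save 2 root-saved)) (root-saved-other 1 (λ ()) (λ ())))
  entry-copied 4 _ _ _ = trans (save-at 3 (save 3 (save 2 root-saved))) (root-saved-other 2 (λ ()) (λ ()))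
  entry-copied 0 () _ _
  entry-copied 1 (s≤s ()) _ _
  entry-copied (suc (suc (suc (suc (suc _))))) _ (s≤s (s≤s (s≤s (s≤s (s≤s ()))))) _

  copy-done : Copy.Copied M E entry (11 + E)
  copy-done = Copy.copy M E (11 + E) refl refl refl entry-source entry-copied entry-root

  open Copy.Copied copy-done using (run-copy; copy-base; copied; root) renaming (mem′ to copied-mem)

  walk-start : Memory
  walk-start = exec (slice 27 30) (upd copied-mem 1 (16 + E))

  setup-cost : ℕ
  setup-cost = 19 + ((8 * (11 + E) + 2) + 3)

  run-setup : ⟨ 0 , M , [] ⟩ ⟶⟨ setup-cost ⟩ ⟨ 30 , walk-start , [] ⟩
  run-setup = run-entry ⨾ run-copy ⨾ ≗-steps (upd-self 1 copy-base) ⨾ computed 3 30 walk-start [] (λ _ → refl)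

  fits : 5 * suc m′ + 2 ≤ E
  fits = begin
    5 * suc m′ + 2 ≡⟨ solve 1 (λ m → con 5 :* (con 1 :+ m) :+ con 2 := con 7 :+ con 5 :* m) refl m′ ⟩
    7 + 5 * m′     ≤⟨ +-mono-≤ (n≤1+n 7) (*-monoˡ-≤ m′ (m≤m+n 5 3)) ⟩
    8 + 8 * m′     ∎
    where open ≤-Reasoning

  tree-copied : ∀ t → RepAt M (suc m′) (M 1) t → RepAt (shifted E walk-start) (suc m′) (walk-start 2) t
  tree-copied t rep = subst (λ i → RepAt (shifted E walk-start) (suc m′) i t) (sym root)
    (RepAt-cong (λ x 2≤x x< → copied x 2≤x (<-≤-trans (<-≤-trans x< fits) (m≤n+m E 16)) (<-≤-trans x< fits)) t rep)

  module _ (t : Tree) (size≡ : size t ≡ suc m′) (rep : RepAt M (suc m′) (M 1) t) where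

    private
      stack-fits : 5 * suc m′ + 2 ≤ 16 + E
      stack-fits = ≤-trans fits (m≤n+m E 16)

      visited : Walk.Visited E (suc m′) stack-fits walk-start [] (E + (16 + E)) t 0
      visited = Walk.visit E (suc m′) stack-fits t [] ≤-refl refl refl refl refl (tree-copied t rep)

      open Walk.Visited visited using (cost; cost≤; run-visit)
        renaming (mem′ to final-mem; sp to final-sp; copy-base to final-copy-base)

    used : ℕ
    used = setup-cost + cost

    used+4≤ : used + 4 ≤ 117 * suc (suc m′)
    used+4≤ = begin
      used + 4
        ≤⟨ +-monoˡ-≤ 4 (+-monoʳ-≤ setup-cost (subst (λ n → cost ≤ 52 * n + 1) size≡ cost≤)) ⟩
      setup-cost + (52 * suc m′ + 1) + 4
        ≡⟨ solve 1 (λ m → con 19 :+ ((con 8 :* (con 11 :+ (con 8 :+ con 8 :* m)) :+ con 2) :+ con 3)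
                           :+ (con 52 :* (con 1 :+ m) :+ con 1) :+ con 4 := con 233 :+ con 116 :* m) refl m′ ⟩
      233 + 116 * m′
        ≤⟨ +-mono-≤ (n≤1+n 233) (*-monoˡ-≤ m′ (n≤1+n 116)) ⟩
      234 + 117 * m′
        ≡⟨ solve 1 (λ m → con 234 :+ con 117 :* m := con 117 :* (con 2 :+ m)) refl m′ ⟩
      117 * suc (suc m′) ∎
      where open ≤-Reasoning

    halts-within : run prog (117 * suc (suc m′)) 0 M [] ≡ just (proj₁ (sweep t 0))
    halts-within = begin
      run prog (117 * suc (suc m′)) 0 M []
        ≡⟨ cong (λ n → run prog n 0 M []) (trans (sym (proj₂ spare)) (+-assoc used 4 k)) ⟩
      run prog (used + (3 + suc k)) 0 M []
        ≡⟨ run-steps whole (3 + suc k) ⟩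
      run prog (3 + suc k) 72 final-mem (reverse (proj₁ (sweep t 0)) ++ [])
        ≡⟨ finish final-mem _ final-sp final-copy-base k ⟩
      just (reverse (reverse (proj₁ (sweep t 0)) ++ []))
        ≡⟨ cong (just ∘ reverse) (++-identityʳ (reverse (proj₁ (sweep t 0)))) ⟩
      just (reverse (reverse (proj₁ (sweep t 0))))
        ≡⟨ cong just (reverse-involutive _) ⟩
      just (proj₁ (sweep t 0)) ∎
      where
      open ≡-Reasoning
      spare : Σ ℕ λ k → used + 4 + k ≡ 117 * suc (suc m′)
      spare = m≤n⇒∃[o]m+o≡n used+4≤
      k : ℕ
      k = proj₁ spare
      whole : ⟨ 0 , M , [] ⟩ ⟶⟨ used ⟩ ⟨ 72 , final-mem , reverse (proj₁ (sweep t 0)) ++ [] ⟩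
      whole = run-setup ⨾ run-visit

prog-computes-sweep : ∀ t M → Rep M t → run prog (117 * suc (size t)) 0 M [] ≡ just (proj₁ (sweep t 0))
prog-computes-sweep leaf M (M0 , _) = run-steps (jmpz-steps 0 {M = M} {o = []} refl (cong (_≡ᵇ 0) M0)) 116
prog-computes-sweep t@(node l _ _ _ r) M (M0 , rep , _) = Setup.halts-within M (size l + size r) M0 t refl rep

theorem3 : Σ Program λ prog → Σ ℕ λ c →
    ∀ (T : Text) (t : Tree) → IsSAVL T t →
    ∀ (M : Memory) → Rep M t →
    run prog (c * suc (size t)) 0 M [] ≡ just (SLCP T t)
theorem3 = prog , 117 , λ T t savl M rep →
  trans (prog-computes-sweep t M rep) (cong just (sweep≡SLCP T t savl))
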